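{- Let $b\ge 2$ and $n\ge 0$ be integers. For all $p,q\in R_b(n)$, we have $p\le q$ if and only if $s(p)_i\ge s(q)_i$ for every $i\ge 0$.
   Context: For an integer $n\ge 0$, a $b$-ary partition of $n$ is a sequence $p=(p_0,p_1,p_2,\dots)$ of non-negative integers, only finitely many nonzero, with $\sum_{i\ge 0}p_ib^i=n$; it is written as a finite tuple $(p_0,\dots,p_{k-1})$, later components being $0$; $(n)$ denotes $(n,0,0,\dots)$. For $i\ge 0$ and a $b$-ary partition $p$ with $p_i\ge b$, "firing $i$" transforms $p$ into the $b$-ary partition $q$ with $q_i=p_i-b$, $q_{i+1}=p_{i+1}+1$ and $q_j=p_j$ for $j\notin\{i,i+1\}$; $q$ is called a successor of $p$. $R_b(n)$ is the set of $b$-ary partitions of $n$ obtainable from $(n)$ by a finite sequence of firings, ordered by: $p\le q$ iff $p$ is obtainable from $q$ by a finite (possibly empty) sequence of firings. For $p\in R_b(n)$, the number of firings of $i$ in a firing sequence from $(n)$ to $p$ does not depend on the chosen sequence; it is denoted $s(p)_i$, and $s(p)=(s(p)_0,s(p)_1,\dots)$ is the shot vector of $p$. -}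

module Defs where

open import Data.Nat using (ℕ; zero; suc; _+_; _∸_; _≤_)
open import Data.Product using (_×_)
open import Relation.Nullary using (¬_)
open import Relation.Binary.PropositionalEquality using (_≡_)

-- A b-ary partition is represented by its infinite sequence of parts
-- p : ℕ → ℕ  (p i = p_i).  Every partition reachable from (n) by firings
-- automatically has finite support and satisfies Σ p_i b^i = n.
Partition : Set
Partition = ℕ → ℕ

single : ℕ → Partition
single n zero    = n
single n (suc _) = 0

-- Fire b i p q : q is the successor of p obtained by firing i
-- (requires p_i ≥ b).  q is specified pointwise (no funext needed).
Fire : ℕ → ℕ → Partition → Partition → Set
Fire b i p q =
  (b ≤ p i) × (q i ≡ p i ∸ b) × (q (suc i) ≡ suc (p (suc i)))
  × (∀ j → ¬ j ≡ i → ¬ j ≡ suc i → q j ≡ p j)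

data FiringSeq (b : ℕ) : Partition → Partition → Set where
  done : ∀ {p q} → (∀ j → p j ≡ q j) → FiringSeq b p q
  step : ∀ {p r q} (i : ℕ) → Fire b i p r → FiringSeq b r q → FiringSeq b p q

firings : ∀ {b p q} → FiringSeq b p q → ℕ → ℕ
firings (done _)       k = 0
firings (step i _ σ)   k with i Data.Nat.≟ k
... | Relation.Nullary.yes _ = suc (firings σ k)
... | Relation.Nullary.no  _ = firings σ k

InR : ℕ → ℕ → Partition → Set
InR b n p = FiringSeq b (single n) p

_≼[_]_ : Partition → ℕ → Partition → Set
p ≼[ b ] q = FiringSeq b q p

-- shot vector of p ∈ R_b(n), computed from a witnessing firing sequence
-- (by the context, independent of the chosen sequence)
shot : ∀ {b n p} → InR b n p → ℕ → ℕ
shot σ = firings σ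

-- Firing i subtracts b from part i and adds 1 to part i+1, so a firing
-- sequence with shot vector s takes m to the partition q with
-- q_j = m_j − b s_j + s_{j−1}.  Read from index 0 upwards, this equation
-- determines s from m and q (b ≠ 0).  Hence if p ≤ q, the shots of (n) → q
-- followed by q → p are the shots of p, giving s(q) ≤ s(p).  Conversely, if
-- s(q) ≤ s(p), fire index 0 until its count reaches s(p)_0, then index 1,
-- and so on: whenever the counts agree with s(p) below k, part k of the
-- current partition exceeds p_k by b times the remaining shots at k, so the
-- next firing is legal; once all counts agree, the partition is p.
module Submission where

open import Data.Nat
  using (ℕ; zero; suc; _+_; _*_; _∸_; _≤_; _<_; _⊔_; _≟_; _<?_; NonZero; s≤s)
open import Data.Nat.Properties
open import Data.Nat.Solver using (module +-*-Solver)
open import Data.Product using (∃-syntax; _,_)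
open import Data.Sum using (inj₁; inj₂)
open import Data.Empty using (⊥-elim)
open import Function using (_∘_)
open import Function.Bundles using (_⇔_; mk⇔)
open import Relation.Nullary using (yes; no)
open import Relation.Binary.PropositionalEquality

open import Defs

δ : ℕ → ℕ → ℕ
δ i k with i ≟ k
... | yes _ = 1
... | no  _ = 0

δ-diag : ∀ i → δ i i ≡ 1
δ-diag i with i ≟ i
... | yes _   = refl
... | no  i≢i = ⊥-elim (i≢i refl)

δ-off : ∀ {i k} → i ≢ k → δ i k ≡ 0
δ-off {i} {k} i≢k with i ≟ k
... | yes i≡k = ⊥-elim (i≢k i≡k)
... | no  _   = refl

firings-step : ∀ {b p r q} i (F : Fire b i p r) (σ : FiringSeq b r q) k →
               firings (step i F σ) k ≡ δ i k + firings σ k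
firings-step i F σ k with i ≟ k
... | yes _ = refl
... | no  _ = refl

firings-finite : ∀ {b p q} (σ : FiringSeq b p q) →
                 ∃[ N ] (∀ j → N ≤ j → firings σ j ≡ 0)
firings-finite (done _) = 0 , λ _ _ → refl
firings-finite (step i F σ) with firings-finite σ
... | N , vanish = suc i ⊔ N , λ j N′≤j → begin
    firings (step i F σ) j ≡⟨ firings-step i F σ j ⟩
    δ i j + firings σ j    ≡⟨ cong₂ _+_
                                (δ-off (<⇒≢ (≤-trans (m≤m⊔n (suc i) N) N′≤j)))
                                (vanish j (≤-trans (m≤n⊔m (suc i) N) N′≤j)) ⟩
    0                      ∎
  where open ≡-Reasoning

-- shift f j = f (j − 1), with the junk value f (−1) = 0.
shift : (ℕ → ℕ) → ℕ → ℕ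
shift f zero    = 0
shift f (suc j) = f j

shift-zero : ∀ j → shift (λ _ → 0) j ≡ 0
shift-zero zero    = refl
shift-zero (suc j) = refl

shift-+ : ∀ f g j → shift (λ k → f k + g k) j ≡ shift f j + shift g j
shift-+ f g zero    = refl
shift-+ f g (suc j) = refl

shift-cong-< : ∀ {f g} k → (∀ j → j < k → f j ≡ g j) → shift f k ≡ shift g k
shift-cong-< zero    f≡g = refl
shift-cong-< (suc k) f≡g = f≡g k ≤-refl

shift-δ-off : ∀ i j → j ≢ suc i → shift (δ i) j ≡ 0
shift-δ-off i zero    _      = refl
shift-δ-off i (suc j) j≢1+i = δ-off (λ i≡j → j≢1+i (cong suc (sym i≡j)))

-- The equation q_j = m_j − b s_j + s_{j−1}, with b s_j moved to the left so
-- that no truncated subtraction occurs.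
record ShotVector (b : ℕ) (m q : Partition) (s : ℕ → ℕ) : Set where
  field balance : ∀ j → q j + b * s j ≡ m j + shift s j

open ShotVector

module _ {b : ℕ} where

  shotVector-cong : ∀ {m q s t} → ShotVector b m q s → (∀ j → s j ≡ t j) →
                    ShotVector b m q t
  shotVector-cong {m} {q} {s} {t} S s≡t .balance j = begin
    q j + b * t j    ≡⟨ cong (λ x → q j + b * x) (sym (s≡t j)) ⟩
    q j + b * s j    ≡⟨ S .balance j ⟩
    m j + shift s j  ≡⟨ cong (m j +_) (shift-cong-< j (λ i _ → s≡t i)) ⟩
    m j + shift t j  ∎
    where open ≡-Reasoning

  shotVector-refl : ∀ {p q} → (∀ j → p j ≡ q j) → ShotVector b p q (λ _ → 0)
  shotVector-refl {p} {q} p≡q .balance j = begin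
    q j + b * 0               ≡⟨ cong (q j +_) (*-zeroʳ b) ⟩
    q j + 0                   ≡⟨ cong (_+ 0) (sym (p≡q j)) ⟩
    p j + 0                   ≡⟨ cong (p j +_) (sym (shift-zero j)) ⟩
    p j + shift (λ _ → 0) j   ∎
    where open ≡-Reasoning

  shotVector-trans : ∀ {m r q s t} → ShotVector b m r s → ShotVector b r q t →
                     ShotVector b m q (λ j → s j + t j)
  shotVector-trans {m} {r} {q} {s} {t} S T .balance j = begin
    q j + b * (s j + t j)                  ≡⟨ solve 4 (λ x y u v → x :+ y :* (u :+ v)
                                                := (x :+ y :* v) :+ y :* u) refl (q j) b (s j) (t j) ⟩
    (q j + b * t j) + b * s j              ≡⟨ cong (_+ b * s j) (T .balance j) ⟩
    (r j + shift t j) + b * s j            ≡⟨ solve 4 (λ x y u v → (x :+ u) :+ y :* v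
                                                := (x :+ y :* v) :+ u) refl (r j) b (shift t j) (s j) ⟩
    (r j + b * s j) + shift t j            ≡⟨ cong (_+ shift t j) (S .balance j) ⟩
    (m j + shift s j) + shift t j          ≡⟨ +-assoc (m j) _ _ ⟩
    m j + (shift s j + shift t j)          ≡⟨ cong (m j +_) (sym (shift-+ s t j)) ⟩
    m j + shift (λ k → s k + t k) j        ∎
    where
    open ≡-Reasoning
    open +-*-Solver

  fire-shotVector : ∀ {i p r} → Fire b i p r → ShotVector b p r (δ i)
  fire-shotVector {i} {p} {r} (b≤pᵢ , rᵢ , r₁₊ᵢ , rⱼ) .balance j with j ≟ i | j ≟ suc i
  ... | yes refl | _ = begin
    r j + b * δ j j      ≡⟨ cong₂ _+_ rᵢ (cong (b *_) (δ-diag j)) ⟩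
    p j ∸ b + b * 1      ≡⟨ cong (p j ∸ b +_) (*-identityʳ b) ⟩
    p j ∸ b + b          ≡⟨ m∸n+n≡m b≤pᵢ ⟩
    p j                  ≡⟨ sym (+-identityʳ (p j)) ⟩
    p j + 0              ≡⟨ cong (p j +_) (sym (shift-δ-off j j (λ j≡1+j → 1+n≢n (sym j≡1+j)))) ⟩
    p j + shift (δ j) j  ∎
    where open ≡-Reasoning
  ... | no j≢i | yes refl = begin
    r (suc i) + b * δ i (suc i)  ≡⟨ cong₂ _+_ r₁₊ᵢ (cong (b *_) (δ-off (λ i≡1+i → j≢i (sym i≡1+i)))) ⟩
    suc (p (suc i)) + b * 0      ≡⟨ cong (suc (p (suc i)) +_) (*-zeroʳ b) ⟩
    suc (p (suc i)) + 0          ≡⟨ +-comm (suc (p (suc i))) 0 ⟩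
    suc (p (suc i))              ≡⟨ +-comm 1 (p (suc i)) ⟩
    p (suc i) + 1                ≡⟨ cong (p (suc i) +_) (sym (δ-diag i)) ⟩
    p (suc i) + δ i i            ∎
    where open ≡-Reasoning
  ... | no j≢i | no j≢1+i = begin
    r j + b * δ i j      ≡⟨ cong₂ _+_ (rⱼ j j≢i j≢1+i) (cong (b *_) (δ-off (λ i≡j → j≢i (sym i≡j)))) ⟩
    p j + b * 0          ≡⟨ cong (p j +_) (*-zeroʳ b) ⟩
    p j + 0              ≡⟨ cong (p j +_) (sym (shift-δ-off i j j≢1+i)) ⟩
    p j + shift (δ i) j  ∎
    where open ≡-Reasoning

  firings-shotVector : ∀ {p q} (σ : FiringSeq b p q) → ShotVector b p q (firings σ)
  firings-shotVector (done p≡q)   = shotVector-refl p≡q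
  firings-shotVector (step i F σ) =
    shotVector-cong (shotVector-trans (fire-shotVector F) (firings-shotVector σ))
                    (λ k → sym (firings-step i F σ k))

  shotVector-level : ∀ {m p q s t} k → ShotVector b m q s → ShotVector b m p t →
                     (∀ j → j < k → s j ≡ t j) → q k + b * s k ≡ p k + b * t k
  shotVector-level {m} {p} {q} {s} {t} k S T s≡t = begin
    q k + b * s k    ≡⟨ S .balance k ⟩
    m k + shift s k  ≡⟨ cong (m k +_) (shift-cong-< k s≡t) ⟩
    m k + shift t k  ≡⟨ sym (T .balance k) ⟩
    p k + b * t k    ∎
    where open ≡-Reasoning

  shotVector-determines : ∀ {m p q s} → ShotVector b m q s → ShotVector b m p s →
                          ∀ j → q j ≡ p j
  shotVector-determines {s = s} S T j =
    +-cancelʳ-≡ (b * s j) _ _ (shotVector-level j S T (λ _ _ → refl))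

  shotVector-unique : .{{_ : NonZero b}} → ∀ {m q s t} →
                      ShotVector b m q s → ShotVector b m q t → ∀ j → s j ≡ t j
  shotVector-unique {q = q} {s} {t} S T j = agree-below (suc j) j ≤-refl
    where
    agree-below : ∀ k j → j < k → s j ≡ t j
    agree-below (suc k) j j<1+k with m<1+n⇒m<n∨m≡n j<1+k
    ... | inj₁ j<k  = agree-below k j j<k
    ... | inj₂ refl = *-cancelˡ-≡ (s j) (t j) b
                        (+-cancelˡ-≡ (q j) _ _ (shotVector-level j S T (agree-below j)))

fire : ℕ → ℕ → Partition → Partition
fire b i q j with j ≟ i
... | yes _ = q i ∸ b
... | no  _ with j ≟ suc i
...   | yes _ = suc (q (suc i))
...   | no  _ = q j

fire-Fire : ∀ b i q → b ≤ q i → Fire b i q (fire b i q)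
fire-Fire b i q b≤qᵢ = b≤qᵢ , at-i , at-1+i , elsewhere
  where
  at-i : fire b i q i ≡ q i ∸ b
  at-i with i ≟ i
  ... | yes _   = refl
  ... | no  i≢i = ⊥-elim (i≢i refl)
  at-1+i : fire b i q (suc i) ≡ suc (q (suc i))
  at-1+i with suc i ≟ i
  ... | yes 1+i≡i = ⊥-elim (1+n≢n 1+i≡i)
  ... | no  _ with suc i ≟ suc i
  ...   | yes _ = refl
  ...   | no  1+i≢1+i = ⊥-elim (1+i≢1+i refl)
  elsewhere : ∀ j → j ≢ i → j ≢ suc i → fire b i q j ≡ q j
  elsewhere j j≢i j≢1+i with j ≟ i
  ... | yes j≡i = ⊥-elim (j≢i j≡i)
  ... | no  _ with j ≟ suc i
  ...   | yes j≡1+i = ⊥-elim (j≢1+i j≡1+i)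
  ...   | no  _ = refl

module Reach {b : ℕ} .{{_ : NonZero b}} {m p : Partition} {t : ℕ → ℕ}
             (T : ShotVector b m p t) {N : ℕ} (t-vanish : ∀ j → N ≤ j → t j ≡ 0) where

  record Stage (k : ℕ) (q : Partition) : Set where
    field
      shots   : ℕ → ℕ
      reached : ShotVector b m q shots
      bounded : ∀ j → shots j ≤ t j
      settled : ∀ j → j < k → shots j ≡ t j

  open Stage

  fireable : ∀ {k q d} (S : Stage k q) → t k ≡ suc d + shots S k → b ≤ q k
  fireable {k} {q} {d} S tₖ = subst (b ≤_) (sym qₖ) (≤-trans (m≤m*n b (suc d)) (m≤n+m _ (p k)))
    where
    qₖ : q k ≡ p k + b * suc d
    qₖ = +-cancelʳ-≡ (b * shots S k) _ _ (begin
      q k + b * shots S k                ≡⟨ shotVector-level k (reached S) T (settled S) ⟩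
      p k + b * t k                      ≡⟨ cong (λ x → p k + b * x) tₖ ⟩
      p k + b * (suc d + shots S k)      ≡⟨ cong (p k +_) (*-distribˡ-+ b (suc d) _) ⟩
      p k + (b * suc d + b * shots S k)  ≡⟨ sym (+-assoc (p k) _ _) ⟩
      p k + b * suc d + b * shots S k    ∎)
      where open ≡-Reasoning

  fire-stage : ∀ {k q d} (S : Stage k q) → t k ≡ suc d + shots S k →
               Stage k (fire b k q)
  fire-stage {k} {q} S tₖ = record
    { shots   = λ j → shots S j + δ k j
    ; reached = shotVector-trans (reached S) (fire-shotVector (fire-Fire b k q (fireable S tₖ)))
    ; bounded = bounded′
    ; settled = settled′
    }
    where
    bounded′ : ∀ j → shots S j + δ k j ≤ t j
    bounded′ j with k ≟ j
    ... | yes refl = subst (_≤ t k) (+-comm 1 (shots S k))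
                       (subst (suc (shots S k) ≤_) (sym tₖ) (s≤s (m≤n+m _ _)))
    ... | no  _    = subst (_≤ t j) (sym (+-identityʳ _)) (bounded S j)
    settled′ : ∀ j → j < k → shots S j + δ k j ≡ t j
    settled′ j j<k = begin
      shots S j + δ k j  ≡⟨ cong (shots S j +_) (δ-off (<⇒≢ j<k ∘ sym)) ⟩
      shots S j + 0      ≡⟨ +-identityʳ _ ⟩
      shots S j          ≡⟨ settled S j j<k ⟩
      t j                ∎
      where open ≡-Reasoning

  settle : ∀ {k q} d (S : Stage k q) → t k ≡ d + shots S k →
           (∀ {q′} → Stage (suc k) q′ → FiringSeq b q′ p) → FiringSeq b q p
  settle {k} zero S tₖ continue = continue record
    { shots = shots S ; reached = reached S ; bounded = bounded S ; settled = settled′ }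
    where
    settled′ : ∀ j → j < suc k → shots S j ≡ t j
    settled′ j j<1+k with m<1+n⇒m<n∨m≡n j<1+k
    ... | inj₁ j<k  = settled S j j<k
    ... | inj₂ refl = sym tₖ
  settle {k} {q} (suc d) S tₖ continue =
    step k (fire-Fire b k q (fireable S tₖ)) (settle d (fire-stage S tₖ) tₖ′ continue)
    where
    tₖ′ : t k ≡ d + (shots S k + δ k k)
    tₖ′ = begin
      t k                      ≡⟨ tₖ ⟩
      suc d + shots S k        ≡⟨ sym (+-suc d (shots S k)) ⟩
      d + suc (shots S k)      ≡⟨ cong (d +_) (+-comm 1 (shots S k)) ⟩
      d + (shots S k + 1)      ≡⟨ cong (λ x → d + (shots S k + x)) (sym (δ-diag k)) ⟩
      d + (shots S k + δ k k)  ∎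
      where open ≡-Reasoning

  reach : ∀ c k {q} → N ≤ k + c → Stage k q → FiringSeq b q p
  reach zero k N≤k S =
    done (shotVector-determines (shotVector-cong (reached S) all-settled) T)
    where
    all-settled : ∀ j → shots S j ≡ t j
    all-settled j with j <? k
    ... | yes j<k = settled S j j<k
    ... | no  j≮k = trans (n≤0⇒n≡0 (subst (shots S j ≤_) t≡0 (bounded S j))) (sym t≡0)
      where
      t≡0 : t j ≡ 0
      t≡0 = t-vanish j (≤-trans (subst (N ≤_) (+-identityʳ k) N≤k) (≮⇒≥ j≮k))
  reach (suc c) k N≤k+1+c S =
    settle (t k ∸ shots S k) S (sym (m∸n+n≡m (bounded S k)))
      (reach c (suc k) (subst (N ≤_) (+-suc k c) N≤k+1+c))

lemma1 : (b n : ℕ) → 2 ≤ b → (p q : Partition)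
         → (σp : InR b n p) → (σq : InR b n q)
         → (p ≼[ b ] q) ⇔ (∀ i → shot σq i ≤ shot σp i)
lemma1 (suc b′) n _ p q σp σq = mk⇔ shots-grow reachable
  where
  b = suc b′

  shots-grow : p ≼[ b ] q → ∀ i → shot σq i ≤ shot σp i
  shots-grow τ i = subst (firings σq i ≤_) (shotVector-unique via-q (firings-shotVector σp) i)
                         (m≤m+n (firings σq i) (firings τ i))
    where
    via-q : ShotVector b (single n) p (λ j → firings σq j + firings τ j)
    via-q = shotVector-trans (firings-shotVector σq) (firings-shotVector τ)

  reachable : (∀ i → shot σq i ≤ shot σp i) → p ≼[ b ] q
  reachable σq≤σp with firings-finite σp
  ... | N , vanish = Reach.reach (firings-shotVector σp) vanish N 0 ≤-refl
      record { shots = firings σq ; reached = firings-shotVector σq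
             ; bounded = σq≤σp ; settled = λ _ () }
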